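{- Let $W$ be the word of $a$'s and $b$'s at a relabeling time $N$. Let $J$ be such that $u_J = N - 1$. Then $W_{J - 1} W_{J} = ``ab" \text{ or } ``ba"$ and $W_{J - 1 - k} = W_{J + k}$ for $k = 1, \dots, N - 2$.
   Context: Fix $\alpha \in \mathbb{R}\setminus\mathbb{Q}$ and $N \in \mathbb{N}$. Order the fractional parts $\{m\alpha\}$, $0 \le m < N$, increasingly as $y_0(N) < \dots < y_{N-1}(N)$, with gaps $\delta_j(N) = y_{j+1}(N)-y_j(N)$ ($j \le N-2$) and $\delta_{N-1}(N) = 1 - y_{N-1}(N)$. The word $W$ has $j^{\text{th}}$ letter $a$, $b$, or $c$ according as $\delta_j(N)$ is the smallest, medium, or largest gap length, read cyclically ($W_j = W_{j \bmod N}$). Let $(u_0,\dots,u_{N-1})$ be the permutation of $(0,\dots,N-1)$ with $\{u_j\alpha\} < \{u_{j+1}\alpha\}$, i.e. $y_j(N) = \{u_j\alpha\}$, interpreted cyclically ($u_j = u_{j \bmod N}$). $N$ is a relabeling time if only two gap lengths occur (labelled $a$ and $b$). Known facts used: $N$ is a relabeling time iff $N = u_1 + u_{N-1}$; at a relabeling time $u_j \equiv j\,u_1 \pmod N$ for $j = 0,\dots,N-1$. -}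

module Defs where

open import Data.Bool using (Bool; true; false; not; _∧_; if_then_else_)
open import Data.Nat using (ℕ; zero; suc; _<_; _≤_; _∸_; _%_; NonZero; _<ᵇ_)
open import Data.Integer as ℤ using (ℤ; +_; -[1+_]; +[1+_])
open import Data.Rational as ℚ using (ℚ; _/_)
open import Data.List using (List; upTo)
open import Data.Bool.ListAction using (all; any)
open import Data.Product using (Σ; ∃; _×_; _,_)
open import Data.Sum using (_⊎_)
open import Relation.Binary.PropositionalEquality using (_≡_)
open import Relation.Nullary using (¬_)

-- An irrational real number α, given by its Dedekind cut.
-- below r = true  iff  r < α.   Since α is irrational, r ≠ α for every
-- rational r, so below r = false iff α < r.  The last field (the upper
-- set has no least element) is exactly the irrationality of α.

record Irrational : Set where
  field
    below        : ℚ → Bool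
    lower-closed : ∀ r s → s ℚ.≤ r → below r ≡ true → below s ≡ true
    inhabited    : ∃ λ r → below r ≡ true
    bounded      : ∃ λ r → below r ≡ false
    no-max       : ∀ r → below r ≡ true → ∃ λ s → r ℚ.< s × below s ≡ true
    no-min-above : ∀ r → below r ≡ false → ∃ λ s → s ℚ.< r × below s ≡ false

open Irrational public

-- Elements p + q·α of ℤ[α], written as pairs (p , q).

Lin : Set
Lin = ℤ × ℤ

_⊕_ : Lin → Lin → Lin
(p , q) ⊕ (p' , q') = (p ℤ.+ p') , (q ℤ.+ q')

⊖_ : Lin → Lin
⊖ (p , q) = ℤ.- p , ℤ.- q

_⊝_ : Lin → Lin → Lin
x ⊝ y = x ⊕ (⊖ y)

pos : Irrational → Lin → Bool
pos α (+ zero , + zero)     = false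
pos α (+[1+ _ ] , + zero)   = true
pos α (-[1+ _ ] , + zero)   = false
pos α (p , +[1+ n ])        = below α (ℤ.- p / suc n)
pos α (p , -[1+ n ])        = not (below α (p / suc n))

ltB : Irrational → Lin → Lin → Bool
ltB α x y = pos α (y ⊝ x)

leB : Irrational → Lin → Lin → Bool
leB α x y = not (ltB α y x)

_<[_]_ : Lin → Irrational → Lin → Set
x <[ α ] y = ltB α x y ≡ true

_≈[_]_ : Lin → Irrational → Lin → Set
x ≈[ α ] y = ¬ (x <[ α ] y) × ¬ (y <[ α ] x)

IsFloor : Irrational → ℕ → ℤ → Set
IsFloor α m f = ¬ ((+ 0 , + m) <[ α ] (f , + 0))
              × ((+ 0 , + m) <[ α ] (f ℤ.+ + 1 , + 0))

frac : (ℕ → ℤ) → ℕ → Lin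
frac fl m = ℤ.- fl m , + m

IsOrderPerm : Irrational → (N : ℕ) → (ℕ → ℤ) → (ℕ → ℕ) → Set
IsOrderPerm α N fl u =
    (∀ j → j < N → u j < N)
  × (∀ m → m < N → Σ ℕ λ j → j < N × u j ≡ m)
  × (∀ j → suc j < N → frac fl (u j) <[ α ] frac fl (u (suc j)))

module _ (α : Irrational) (N : ℕ) .{{_ : NonZero N}} (fl : ℕ → ℤ) (u : ℕ → ℕ) where

  uc : ℕ → ℕ
  uc j = u (j % N)

  gap : ℕ → Lin
  gap j = if suc (j % N) <ᵇ N
            then frac fl (u (suc (j % N))) ⊝ frac fl (u (j % N))
            else (+ 1 , + 0) ⊝ frac fl (u (j % N))

  RelabelingTime : Set
  RelabelingTime =
    Σ ℕ λ i → Σ ℕ λ k → i < N × k < N × ¬ (gap i ≈[ α ] gap k)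
      × (∀ j → j < N → (gap j ≈[ α ] gap i) ⊎ (gap j ≈[ α ] gap k))

  isMin : ℕ → Bool
  isMin j = all (λ i → leB α (gap j) (gap i)) (upTo N)

  isMax : ℕ → Bool
  isMax j = all (λ i → leB α (gap i) (gap j)) (upTo N)

  hasMiddle : Bool
  hasMiddle = any (λ i → not (isMin i) ∧ not (isMax i)) (upTo N)

data Letter : Set where
  a b c : Letter

word : (α : Irrational) (N : ℕ) .{{_ : NonZero N}} → (ℕ → ℤ) → (ℕ → ℕ) → ℕ → Letter
word α N fl u j =
  if isMin α N fl u j then a
  else if isMax α N fl u j ∧ hasMiddle α N fl u then c
  else b

{-# OPTIONS --safe #-}
-- Numbers p + qα are compared through the Dedekind cut of α; since α is irrational,
-- equal numbers have equal coordinates, so gap lengths can be compared by their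
-- α-coefficients. At a relabeling time every gap is g = {Aα} (α-coefficient A = u₁)
-- or h = 1 − {Bα} (α-coefficient −B, B = u_{N−1}); hence u_{j+1} = u_j + A across a
-- g-gap and u_{j+1} = u_j − B across an h-gap. Minimality of {Aα} and maximality of
-- {Bα} force A + B = N, after which the gap at j is g exactly when u_j < B. So the
-- gap ending at u_J = N − 1 is g and the gap starting there is h. Walking right from
-- J and left from J − 1, u moves by opposite steps, so the two positions always sum
-- to B − 2 modulo N; lying in [0, 2N − 2], the sum is B − 2 or N + B − 2, which
-- puts both positions below B or both at least B, i.e. gives mirrored letters.
module Submission where

open import Defs
open import Data.Bool using (Bool; true; false; not; T; _∧_; if_then_else_)
open import Data.Bool.Properties using (T-≡; ¬-not; ∧-zeroʳ)
open import Data.Bool.ListAction using (all; any)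
open import Data.List using (upTo)
open import Data.List.Relation.Unary.All.Properties using (applyUpTo⁺₁; applyUpTo⁻; all⁺; all⁻; All¬⇒¬Any)
open import Data.List.Relation.Unary.Any.Properties using (any⁻)
open import Data.Product using (Σ; _×_; _,_; proj₁; proj₂)
open import Data.Sum using (_⊎_; inj₁; inj₂)
import Data.Sum
open import Data.Empty using (⊥; ⊥-elim)
open import Relation.Nullary using (¬_; yes; no)
open import Relation.Binary using (tri<; tri≈; tri>)
open import Relation.Binary.PropositionalEquality
open import Function using (_∘_; id; Equivalence)

module RealOrder (α : Irrational) where
  open import Data.Nat as ℕ using (ℕ; zero; suc)
  import Data.Nat.Properties as ℕ
  open import Data.Integer using (ℤ; +_; -[1+_]; +[1+_]; _+_; _*_; -_; _-_; _≤_; _<_; +<+; +≤+)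
  import Data.Integer.Properties as ℤ
  open import Data.Integer.Tactic.RingSolver using (solve-∀)
  import Data.Rational as ℚ
  import Data.Rational.Properties as ℚ
  import Data.Rational.Unnormalised as ℚᵘ
  import Data.Rational.Unnormalised.Properties as ℚᵘ

  -- k / (n + 1) < α; a record rather than a definition so that k and n are
  -- inferable from the type.
  record Below (k : ℤ) (n : ℕ) : Set where
    constructor below✓
    field holds : below α (k ℚ./ suc n) ≡ true

  Below-downward : ∀ {k n k' n'} → k' * + suc n ≤ k * + suc n' → Below k n → Below k' n'
  Below-downward {k} {n} {k'} {n'} k'n≤kn' (below✓ h) = below✓ (lower-closed α _ _ k'/n'≤k/n h)
    where
    k'/n'≤k/n : k' ℚ./ suc n' ℚ.≤ k ℚ./ suc n
    k'/n'≤k/n = ℚ.toℚᵘ-cancel-≤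
      (ℚᵘ.≤-respʳ-≃ (ℚᵘ.≃-sym (ℚ.toℚᵘ-fromℚᵘ (ℚᵘ.mkℚᵘ k n)))
        (ℚᵘ.≤-respˡ-≃ (ℚᵘ.≃-sym (ℚ.toℚᵘ-fromℚᵘ (ℚᵘ.mkℚᵘ k' n'))) (ℚᵘ.*≤* k'n≤kn')))

  Below-separates : ∀ {k n k' n'} → Below k n → ¬ Below k' n' → k * + suc n' < k' * + suc n
  Below-separates below ¬below = ℤ.≰⇒> λ le → ¬below (Below-downward le below)

  Pos : Lin → Set
  Pos x = pos α x ≡ true

  Pos-ℤ⇒0< : ∀ p → Pos (p , + 0) → + 0 < p
  Pos-ℤ⇒0< +[1+ n ] _ = +<+ ℕ.z<s

  0<⇒Pos-ℤ : ∀ p → + 0 < p → Pos (p , + 0)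
  0<⇒Pos-ℤ +[1+ n ] _ = refl
  0<⇒Pos-ℤ (+ zero) (+<+ ())

  pos⁺ : ∀ p n → pos α (p , +[1+ n ]) ≡ below α (- p ℚ./ suc n)
  pos⁺ (+ zero)  n = refl
  pos⁺ +[1+ m ] n = refl
  pos⁺ -[1+ m ] n = refl

  pos⁻ : ∀ p n → pos α (p , -[1+ n ]) ≡ not (below α (p ℚ./ suc n))
  pos⁻ (+ zero)  n = refl
  pos⁻ +[1+ m ] n = refl
  pos⁻ -[1+ m ] n = refl

  not-true⇒≢true : ∀ {x} → not x ≡ true → x ≢ true
  not-true⇒≢true {false} _ ()

  ≢true⇒not-true : ∀ {x} → x ≢ true → not x ≡ true
  ≢true⇒not-true {false} _   = refl
  ≢true⇒not-true {true}  x≢ = ⊥-elim (x≢ refl)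

  Pos⁺⇒Below : ∀ p n → Pos (p , +[1+ n ]) → Below (- p) n
  Pos⁺⇒Below p n h = below✓ (trans (sym (pos⁺ p n)) h)

  Below⇒Pos⁺ : ∀ p n → Below (- p) n → Pos (p , +[1+ n ])
  Below⇒Pos⁺ p n (below✓ h) = trans (pos⁺ p n) h

  Pos⁻⇒¬Below : ∀ p n → Pos (p , -[1+ n ]) → ¬ Below p n
  Pos⁻⇒¬Below p n h (below✓ holds) = not-true⇒≢true (trans (sym (pos⁻ p n)) h) holds

  ¬Below⇒Pos⁻ : ∀ p n → ¬ Below p n → Pos (p , -[1+ n ])
  ¬Below⇒Pos⁻ p n h = trans (pos⁻ p n) (≢true⇒not-true (h ∘ below✓))

  ≤-by-difference : ∀ {x y w} → y - x ≡ w → + 0 ≤ w → x ≤ y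
  ≤-by-difference refl 0≤w = ℤ.0≤i-j⇒j≤i 0≤w

  0<-difference : ∀ {x y} → x < y → + 0 < y - x
  0<-difference {x} {y} x<y = subst (_< y - x) (ℤ.+-inverseʳ x) (ℤ.+-monoˡ-< (- x) x<y)

  0≤*suc : ∀ {p} n → + 0 < p → + 0 ≤ p * + suc n
  0≤*suc {+[1+ m ]} n _ = +≤+ ℕ.z≤n
  0≤*suc {+ zero} n (+<+ ())

  Pos-⊕-ℤ⁺ : ∀ p p' n' → Pos (p , + 0) → Below (- p') n' → Below (- (p + p')) n'
  Pos-⊕-ℤ⁺ p p' n' pos below = Below-downward
      (≤-by-difference (identity p p' (+ suc n')) (0≤*suc n' (Pos-ℤ⇒0< p pos))) below
    where
    identity : ∀ p p' d → (- p') * d - (- (p + p')) * d ≡ p * d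
    identity = solve-∀

  Pos-⊕-ℤ⁻ : ∀ p p' n' → Pos (p , + 0) → ¬ Below p' n' → ¬ Below (p + p') n'
  Pos-⊕-ℤ⁻ p p' n' pos ¬below below = ¬below (Below-downward
      (≤-by-difference (identity p p' (+ suc n')) (0≤*suc n' (Pos-ℤ⇒0< p pos))) below)
    where
    identity : ∀ p p' d → (p + p') * d - p' * d ≡ p * d
    identity = solve-∀

  -- The mediant of two fractions lies between them.
  Below-mediant : ∀ p p' n n' → Below (- p) n → Below (- p') n' → Below (- (p + p')) (n ℕ.+ suc n')
  Below-mediant p p' n n' below below' with ℤ.≤-total ((- p') * + suc n) ((- p) * + suc n')
  ... | inj₁ le = Below-downward
        (≤-by-difference (identity p p' (+ suc n) (+ suc n')) (ℤ.i≤j⇒0≤j-i le)) below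
    where
    identity : ∀ p p' d d' → (- p) * (d + d') - (- (p + p')) * d ≡ (- p) * d' - (- p') * d
    identity = solve-∀
  ... | inj₂ le = Below-downward
        (≤-by-difference (identity p p' (+ suc n) (+ suc n')) (ℤ.i≤j⇒0≤j-i le)) below'
    where
    identity : ∀ p p' d d' → (- p') * (d + d') - (- (p + p')) * d' ≡ (- p') * d - (- p) * d'
    identity = solve-∀

  sum-of-denominators : ∀ n n' → + suc (suc (n ℕ.+ n')) ≡ + suc n + + suc n'
  sum-of-denominators n n' = cong (λ m → + suc m) (sym (ℕ.+-suc n n'))

  ¬Below-mediant : ∀ p p' n n' → ¬ Below p n → ¬ Below p' n' → ¬ Below (p + p') (suc (n ℕ.+ n'))
  ¬Below-mediant p p' n n' ¬below ¬below' below with ℤ.≤-total (p * + suc n') (p' * + suc n)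
  ... | inj₁ le = ¬below (Below-downward
        (subst (λ z → p * z ≤ (p + p') * + suc n) (sym (sum-of-denominators n n'))
          (≤-by-difference (identity p p' (+ suc n) (+ suc n')) (ℤ.i≤j⇒0≤j-i le))) below)
    where
    identity : ∀ p p' d d' → (p + p') * d - p * (d + d') ≡ p' * d - p * d'
    identity = solve-∀
  ... | inj₂ le = ¬below' (Below-downward
        (subst (λ z → p' * z ≤ (p + p') * + suc n') (sym (sum-of-denominators n n'))
          (≤-by-difference (identity p p' (+ suc n) (+ suc n')) (ℤ.i≤j⇒0≤j-i le))) below)
    where
    identity : ∀ p p' d d' → (p + p') * d' - p' * (d + d') ≡ p * d' - p' * d
    identity = solve-∀

  Pos-⊕-mixed : ∀ p p' n n' s → s ≡ + suc n - + suc n' →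
                Below (- p) n → ¬ Below p' n' → Pos (p + p' , s)
  Pos-⊕-mixed p p' n n' (+ zero) s≡ below ¬below =
      0<⇒Pos-ℤ (p + p') (ℤ.*-cancelʳ-<-nonNeg (+ suc n) (subst (+ 0 <_) (identity p p' (+ suc n)) 0<diff))
    where
    identity : ∀ p p' d → p' * d - (- p) * d ≡ (p + p') * d
    identity = solve-∀
    same-denominator : + suc n ≡ + suc n'
    same-denominator = ℤ.i-j≡0⇒i≡j _ _ (sym s≡)
    0<diff : + 0 < p' * + suc n - (- p) * + suc n
    0<diff = subst (λ d → + 0 < p' * + suc n - (- p) * d) (sym same-denominator)
            (0<-difference (Below-separates below ¬below))
  Pos-⊕-mixed p p' n n' +[1+ m ] s≡ below ¬below = Below⇒Pos⁺ (p + p') m (Below-downward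
      (subst (λ d → (- (p + p')) * + suc n ≤ (- p) * d) (sym s≡)
        (≤-by-difference (identity p p' (+ suc n) (+ suc n'))
          (ℤ.<⇒≤ (0<-difference (Below-separates below ¬below))))) below)
    where
    identity : ∀ p p' d d' → (- p) * (d - d') - (- (p + p')) * d ≡ p' * d - (- p) * d'
    identity = solve-∀
  Pos-⊕-mixed p p' n n' -[1+ m ] s≡ below ¬below = ¬Below⇒Pos⁻ (p + p') m λ below' → ¬below
      (Below-downward
        (subst (λ d → p' * d ≤ (p + p') * + suc n') (sym -s≡)
          (≤-by-difference (identity p p' (+ suc n) (+ suc n'))
            (ℤ.<⇒≤ (0<-difference (Below-separates below ¬below))))) below')
    where
    identity : ∀ p p' d d' → (p + p') * d' - p' * (d' - d) ≡ p' * d - (- p) * d'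
    identity = solve-∀
    negate : ∀ d d' → - (d - d') ≡ d' - d
    negate = solve-∀
    -s≡ : + suc m ≡ + suc n' - + suc n
    -s≡ = trans (cong -_ s≡) (negate (+ suc n) (+ suc n'))

  ⊕-comm : ∀ x y → x ⊕ y ≡ y ⊕ x
  ⊕-comm (p , q) (p' , q') = cong₂ _,_ (ℤ.+-comm p p') (ℤ.+-comm q q')

  Pos-⊕ : ∀ x y → Pos x → Pos y → Pos (x ⊕ y)
  Pos-⊕ (p , + zero) (p' , + zero) h h' = 0<⇒Pos-ℤ (p + p') (ℤ.+-mono-< (Pos-ℤ⇒0< p h) (Pos-ℤ⇒0< p' h'))
  Pos-⊕ (p , + zero) (p' , +[1+ n' ]) h h' =
    Below⇒Pos⁺ (p + p') n' (Pos-⊕-ℤ⁺ p p' n' h (Pos⁺⇒Below p' n' h'))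
  Pos-⊕ (p , + zero) (p' , -[1+ n' ]) h h' =
    ¬Below⇒Pos⁻ (p + p') n' (Pos-⊕-ℤ⁻ p p' n' h (Pos⁻⇒¬Below p' n' h'))
  Pos-⊕ (p , +[1+ n ]) (p' , +[1+ n' ]) h h' =
    Below⇒Pos⁺ (p + p') _ (Below-mediant p p' n n' (Pos⁺⇒Below p n h) (Pos⁺⇒Below p' n' h'))
  Pos-⊕ (p , -[1+ n ]) (p' , -[1+ n' ]) h h' =
    ¬Below⇒Pos⁻ (p + p') _ (¬Below-mediant p p' n n' (Pos⁻⇒¬Below p n h) (Pos⁻⇒¬Below p' n' h'))
  Pos-⊕ (p , +[1+ n ]) (p' , -[1+ n' ]) h h' =
    Pos-⊕-mixed p p' n n' _ refl (Pos⁺⇒Below p n h) (Pos⁻⇒¬Below p' n' h')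
  Pos-⊕ x@(_ , +[1+ _ ]) y@(_ , + zero)    h h' = subst Pos (⊕-comm y x) (Pos-⊕ y x h' h)
  Pos-⊕ x@(_ , -[1+ _ ]) y@(_ , + zero)    h h' = subst Pos (⊕-comm y x) (Pos-⊕ y x h' h)
  Pos-⊕ x@(_ , -[1+ _ ]) y@(_ , +[1+ _ ]) h h' = subst Pos (⊕-comm y x) (Pos-⊕ y x h' h)

  -- The cut is Boolean, so no rational equals α: p + qα with q ≠ 0 is never 0.
  Pos-trichotomy : ∀ x → Pos x ⊎ x ≡ (+ 0 , + 0) ⊎ Pos (⊖ x)
  Pos-trichotomy (+ zero , + zero)   = inj₂ (inj₁ refl)
  Pos-trichotomy (+[1+ m ] , + zero) = inj₁ refl
  Pos-trichotomy (-[1+ m ] , + zero) = inj₂ (inj₂ refl)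
  Pos-trichotomy (p , +[1+ n ]) with below α (- p ℚ./ suc n) in eq
  ... | true  = inj₁ (trans (pos⁺ p n) eq)
  ... | false = inj₂ (inj₂ (trans (pos⁻ (- p) n) (cong not eq)))
  Pos-trichotomy (p , -[1+ n ]) with below α (p ℚ./ suc n) in eq
  ... | true  = inj₂ (inj₂ (trans (pos⁺ (- p) n)
                  (trans (cong (λ k → below α (k ℚ./ suc n)) (ℤ.neg-involutive p)) eq)))
  ... | false = inj₁ (trans (pos⁻ p n) (cong not eq))

  Pos-asym : ∀ x → Pos x → ¬ Pos (⊖ x)
  Pos-asym (+[1+ m ] , + zero) _ ()
  Pos-asym (p , +[1+ n ]) h h' =
    Pos⁻⇒¬Below (- p) n h' (Pos⁺⇒Below p n h)
  Pos-asym (p , -[1+ n ]) h h' =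
    Pos⁻⇒¬Below p n h (subst (λ k → Below k n) (ℤ.neg-involutive p) (Pos⁺⇒Below (- p) n h'))

  Pos-⊕-ℕ : ∀ x n → Pos x → Pos (x ⊕ (+ n , + 0))
  Pos-⊕-ℕ (p , q) zero    pos = subst Pos (sym (cong₂ _,_ (ℤ.+-identityʳ p) (ℤ.+-identityʳ q))) pos
  Pos-⊕-ℕ x       (suc n) pos = Pos-⊕ x (+ suc n , + 0) pos refl

  ⊝-telescope : ∀ x y z → (z ⊝ y) ⊕ (y ⊝ x) ≡ z ⊝ x
  ⊝-telescope (x , x') (y , y') (z , z') = cong₂ _,_ (identity z y x) (identity z' y' x')
    where
    identity : ∀ z y x → (z + - y) + (y + - x) ≡ z + - x
    identity = solve-∀

  ⊝-flip : ∀ x y → x ⊝ y ≡ ⊖ (y ⊝ x)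
  ⊝-flip (x , x') (y , y') = cong₂ _,_ (identity y x) (identity y' x')
    where
    identity : ∀ y x → x + - y ≡ - (y + - x)
    identity = solve-∀

  ⊝-self : ∀ x → x ⊝ x ≡ (+ 0 , + 0)
  ⊝-self (p , q) = cong₂ _,_ (ℤ.+-inverseʳ p) (ℤ.+-inverseʳ q)

  ⊝≡0⇒≡ : ∀ y x → y ⊝ x ≡ (+ 0 , + 0) → y ≡ x
  ⊝≡0⇒≡ (p , q) (p' , q') e =
    cong₂ _,_ (ℤ.i-j≡0⇒i≡j p p' (cong proj₁ e)) (ℤ.i-j≡0⇒i≡j q q' (cong proj₂ e))

  lt-trans : ∀ x y z → x <[ α ] y → y <[ α ] z → x <[ α ] z
  lt-trans x y z x<y y<z = subst Pos (⊝-telescope x y z) (Pos-⊕ (z ⊝ y) (y ⊝ x) y<z x<y)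

  0<⇒Pos : ∀ x → (+ 0 , + 0) <[ α ] x → Pos x
  0<⇒Pos (p , q) = subst Pos (cong₂ _,_ (ℤ.+-identityʳ p) (ℤ.+-identityʳ q))

  lt-irrefl : ∀ x → ¬ (x <[ α ] x)
  lt-irrefl x x<x with () ← trans (sym (cong (pos α) (⊝-self x))) x<x

  lt-asym : ∀ x y → x <[ α ] y → ¬ (y <[ α ] x)
  lt-asym x y x<y y<x = Pos-asym (y ⊝ x) x<y (subst Pos (⊝-flip x y) y<x)

  lt-cmp : ∀ x y → x <[ α ] y ⊎ y ≡ x ⊎ y <[ α ] x
  lt-cmp x y with Pos-trichotomy (y ⊝ x)
  ... | inj₁ x<y        = inj₁ x<y
  ... | inj₂ (inj₁ y-x≡0) = inj₂ (inj₁ (⊝≡0⇒≡ y x y-x≡0))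
  ... | inj₂ (inj₂ y<x) = inj₂ (inj₂ (subst Pos (sym (⊝-flip x y)) y<x))

  ≮⇒leB : ∀ x y → ¬ (y <[ α ] x) → leB α x y ≡ true
  ≮⇒leB x y = ≢true⇒not-true

  leB⇒≮ : ∀ x y → leB α x y ≡ true → ¬ (y <[ α ] x)
  leB⇒≮ x y = not-true⇒≢true

  ≈⇒≡ : ∀ {x y} → x ≈[ α ] y → x ≡ y
  ≈⇒≡ {x} {y} (x≮y , y≮x) with lt-cmp x y
  ... | inj₁ x<y        = ⊥-elim (x≮y x<y)
  ... | inj₂ (inj₁ y≡x) = sym y≡x
  ... | inj₂ (inj₂ y<x) = ⊥-elim (y≮x y<x)

  ≡⇒≈ : ∀ {x y} → x ≡ y → x ≈[ α ] y
  ≡⇒≈ {x} refl = lt-irrefl x , lt-irrefl x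

open import Data.Nat
  using (ℕ; zero; suc; _+_; _∸_; _*_; _<_; _≤_; s≤s; z<s; NonZero; >-nonZero⁻¹; ≢-nonZero; _%_; _<ᵇ_; _≟_; _<?_)
open import Data.Nat.Properties
open import Data.Nat.DivMod
open import Data.Nat.Tactic.RingSolver using (solve-∀)
open import Data.Integer using (ℤ; +_; -[1+_]; +[1+_])
import Data.Integer as ℤ
import Data.Integer.Properties as ℤ
import Data.Integer.Tactic.RingSolver as ℤ-Solver

sum+2≤N+N : ∀ {N p q} → p < N → q < N → p + q + 2 ≤ N + N
sum+2≤N+N {N} {p} {q} p<N q<N = subst (_≤ N + N) (identity p q) (+-mono-≤ p<N q<N)
  where
  identity : ∀ p q → suc p + suc q ≡ p + q + 2
  identity = solve-∀

[m+k]%n≢m : ∀ {m k n} .{{_ : NonZero n}} → m < n → 0 < k → k < n → (m + k) % n ≢ m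
[m+k]%n≢m {m} {k} {n} m<n 0<k k<n [m+k]%n≡m with m + k <? n
... | yes m+k<n = <⇒≢ 0<k (sym (+-cancelˡ-≡ m k 0 (begin
      m + k        ≡⟨ m<n⇒m%n≡m m+k<n ⟨
      (m + k) % n  ≡⟨ [m+k]%n≡m ⟩
      m            ≡⟨ +-identityʳ m ⟨
      m + 0        ∎)))
  where open ≡-Reasoning
... | no m+k≮n = <⇒≢ k<n (+-cancelˡ-≡ m k n (begin
      m + k        ≡⟨ r+n≡m+k ⟨
      r + n        ≡⟨ cong (_+ n) r≡m ⟩
      m + n        ∎))
  where
  open ≡-Reasoning
  r = m + k ∸ n
  r+n≡m+k : r + n ≡ m + k
  r+n≡m+k = m∸n+n≡m (≮⇒≥ m+k≮n)
  r<n : r < n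
  r<n = +-cancelʳ-< n r n (subst (_< n + n) (sym r+n≡m+k) (+-mono-< m<n k<n))
  r≡m : r ≡ m
  r≡m = begin
    r            ≡⟨ m<n⇒m%n≡m r<n ⟨
    r % n        ≡⟨ [m+n]%n≡m%n r n ⟨
    (r + n) % n  ≡⟨ cong (_% n) r+n≡m+k ⟩
    (m + k) % n  ≡⟨ [m+k]%n≡m ⟩
    m            ∎

suc[m%n]%n≡suc[m]%n : ∀ m n .{{_ : NonZero n}} → suc (m % n) % n ≡ suc m % n
suc[m%n]%n≡suc[m]%n m n = begin
  (1 + m % n) % n          ≡⟨ %-distribˡ-+ 1 (m % n) n ⟩
  (1 % n + m % n % n) % n  ≡⟨ cong (λ r → (1 % n + r) % n) (m%n%n≡m%n m n) ⟩
  (1 % n + m % n) % n      ≡⟨ %-distribˡ-+ 1 m n ⟨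
  (1 + m) % n              ∎
  where open ≡-Reasoning

all-upTo-true : ∀ (f : ℕ → Bool) n → (∀ {i} → i < n → f i ≡ true) → all f (upTo n) ≡ true
all-upTo-true f n h = Equivalence.to T-≡ (all⁻ f (applyUpTo⁺₁ id n (Equivalence.from T-≡ ∘ h)))

all-upTo-true⁻ : ∀ (f : ℕ → Bool) n → all f (upTo n) ≡ true → ∀ {i} → i < n → f i ≡ true
all-upTo-true⁻ f n h = Equivalence.to T-≡ ∘ applyUpTo⁻ id n (all⁺ f _ (Equivalence.from T-≡ h))

any-upTo-false : ∀ (f : ℕ → Bool) n → (∀ {i} → i < n → f i ≡ false) → any f (upTo n) ≡ false
any-upTo-false f n h = ¬-not λ any≡true →
  All¬⇒¬Any (applyUpTo⁺₁ id n λ i<n → subst T (h i<n))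
            (any⁻ f (upTo n) (Equivalence.from T-≡ any≡true))

one-of-two : ∀ {A : Set} {p q g h x : A} → g ≢ h →
             g ≡ p ⊎ g ≡ q → h ≡ p ⊎ h ≡ q → x ≡ p ⊎ x ≡ q → x ≡ g ⊎ x ≡ h
one-of-two g≢h (inj₁ refl) _           (inj₁ refl) = inj₁ refl
one-of-two g≢h (inj₂ refl) _           (inj₂ refl) = inj₁ refl
one-of-two g≢h (inj₁ refl) (inj₂ refl) (inj₂ refl) = inj₂ refl
one-of-two g≢h (inj₂ refl) (inj₁ refl) (inj₁ refl) = inj₂ refl
one-of-two g≢h (inj₁ refl) (inj₁ refl) _           = ⊥-elim (g≢h refl)
one-of-two g≢h (inj₂ refl) (inj₂ refl) _           = ⊥-elim (g≢h refl)

ℤ-difference⁺ : ∀ m n k → + m ℤ.- + n ≡ + k → m ≡ n + k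
ℤ-difference⁺ m n k m-n≡k = ℤ.+-injective (begin
  + m                    ≡⟨ identity (+ m) (+ n) ⟩
  (+ m ℤ.- + n) ℤ.+ + n  ≡⟨ cong (ℤ._+ + n) m-n≡k ⟩
  + (k + n)              ≡⟨ cong +_ (+-comm k n) ⟩
  + (n + k)              ∎)
  where
  open ≡-Reasoning
  identity : ∀ m n → m ≡ (m ℤ.- n) ℤ.+ n
  identity = ℤ-Solver.solve-∀

ℤ-difference⁻ : ∀ m n k → + m ℤ.- + n ≡ ℤ.- + k → m + k ≡ n
ℤ-difference⁻ m n k m-n≡-k = ℤ.+-injective (begin
  + m ℤ.+ + k                       ≡⟨ identity (+ m) (+ n) (+ k) ⟩
  (+ m ℤ.- + n) ℤ.+ + k ℤ.+ + n     ≡⟨ cong (λ d → d ℤ.+ + k ℤ.+ + n) m-n≡-k ⟩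
  ℤ.- + k ℤ.+ + k ℤ.+ + n           ≡⟨ identity′ (+ k) (+ n) ⟩
  + n                               ∎)
  where
  open ≡-Reasoning
  identity : ∀ m n k → m ℤ.+ k ≡ (m ℤ.- n) ℤ.+ k ℤ.+ n
  identity = ℤ-Solver.solve-∀
  identity′ : ∀ k n → ℤ.- k ℤ.+ k ℤ.+ n ≡ n
  identity′ = ℤ-Solver.solve-∀

SumInvariant : (N B s : ℕ) → Set
SumInvariant N B s = s + 2 ≡ B ⊎ s + 2 ≡ N + B

-- One step p ↦ p + A or p ↦ p − B, where A + B = N, moves p by A modulo N.
opposite-steps : ∀ {N A B p q p' q'} → A + B ≡ N →
                 p' ≡ p + A ⊎ p' + B ≡ p → q ≡ q' + A ⊎ q + B ≡ q' →
                 p' + q' ≡ p + q ⊎ p' + q' ≡ p + q + N ⊎ p' + q' + N ≡ p + q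
opposite-steps {A = A} {p = p} {q' = q'} _ (inj₁ refl) (inj₁ refl) = inj₁ (identity p A q')
  where
  identity : ∀ p A q' → p + A + q' ≡ p + (q' + A)
  identity = solve-∀
opposite-steps {B = B} {q = q} {p' = p'} _ (inj₂ refl) (inj₂ refl) =
  inj₁ (+-cancelʳ-≡ B _ _ (identity p' B q))
  where
  identity : ∀ p' B q → p' + (q + B) + B ≡ p' + B + q + B
  identity = solve-∀
opposite-steps {A = A} {B} {p} {q} refl (inj₁ refl) (inj₂ refl) = inj₂ (inj₁ (identity p A q B))
  where
  identity : ∀ p A q B → p + A + (q + B) ≡ p + q + (A + B)
  identity = solve-∀
opposite-steps {A = A} {B} {p' = p'} {q' = q'} refl (inj₂ refl) (inj₁ refl) =
  inj₂ (inj₂ (identity p' B q' A))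
  where
  identity : ∀ p' B q' A → p' + q' + (A + B) ≡ p' + B + (q' + A)
  identity = solve-∀

SumInvariant-step : ∀ {N B s s'} → 0 < B → B < N → s' + 2 ≤ N + N →
                    s' ≡ s ⊎ s' ≡ s + N ⊎ s' + N ≡ s →
                    SumInvariant N B s → SumInvariant N B s'
SumInvariant-step _ _ _ (inj₁ refl) inv = inv
SumInvariant-step {N} {B} {s} _ _ _ (inj₂ (inj₁ refl)) (inj₁ s+2≡B) =
  inj₂ (trans (identity s N) (cong (λ k → N + k) s+2≡B))
  where
  identity : ∀ s N → s + N + 2 ≡ N + (s + 2)
  identity = solve-∀
SumInvariant-step {N} {B} {s} 0<B _ bound (inj₂ (inj₁ refl)) (inj₂ s+2≡N+B) =
  ⊥-elim (<⇒≱ too-big bound)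
  where
  identity : ∀ s N → s + N + 2 ≡ N + (s + 2)
  identity = solve-∀
  too-big : N + N < s + N + 2
  too-big = begin-strict
    N + N       ≡⟨ +-identityʳ (N + N) ⟨
    N + N + 0   <⟨ +-monoʳ-< (N + N) 0<B ⟩
    N + N + B   ≡⟨ +-assoc N N B ⟩
    N + (N + B) ≡⟨ cong (λ k → N + k) s+2≡N+B ⟨
    N + (s + 2) ≡⟨ identity s N ⟨
    s + N + 2   ∎
    where open ≤-Reasoning
SumInvariant-step {N} {B} {s' = s'} _ B<N _ (inj₂ (inj₂ refl)) (inj₁ s+2≡B) =
  ⊥-elim (<⇒≱ B<N (begin
    N             ≤⟨ m≤n+m N (s' + 2) ⟩
    s' + 2 + N    ≡⟨ identity s' N ⟩
    s' + N + 2    ≡⟨ s+2≡B ⟩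
    B             ∎))
  where
  open ≤-Reasoning
  identity : ∀ s' N → s' + 2 + N ≡ s' + N + 2
  identity = solve-∀
SumInvariant-step {N} {B} {s' = s'} _ _ _ (inj₂ (inj₂ refl)) (inj₂ s+2≡N+B) =
  inj₁ (+-cancelˡ-≡ N _ _ (trans (identity s' N) s+2≡N+B))
  where
  identity : ∀ s' N → N + (s' + 2) ≡ s' + N + 2
  identity = solve-∀

SumInvariant-sides : ∀ {N B p q} → p < N → q < N → suc p ≢ N → suc p ≢ B →
                     SumInvariant N B (p + q) → (p < B × q < B) ⊎ (B ≤ p × B ≤ q)
SumInvariant-sides {N} {B} {p} {q} _ _ _ _ (inj₁ p+q+2≡B) = inj₁ (p<B , q<B)
  where
  p<B : p < B
  p<B = subst (p <_) p+q+2≡B (≤-<-trans (m≤m+n p q) (m<m+n (p + q) z<s))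
  q<B : q < B
  q<B = subst (q <_) p+q+2≡B (≤-<-trans (m≤n+m q p) (m<m+n (p + q) z<s))
SumInvariant-sides {N} {B} {p} {q} p<N q<N 1+p≢N 1+p≢B (inj₂ p+q+2≡N+B) = inj₂ (B≤p , B≤q)
  where
  identity : ∀ p q → q + (p + 2) ≡ p + q + 2
  identity = solve-∀
  B≤p : B ≤ p
  B≤p = ≮⇒≥ λ p<B → <⇒≱ q<N (+-cancelʳ-≤ B N q (begin
    N + B           ≡⟨ p+q+2≡N+B ⟨
    p + q + 2       ≡⟨ identity p q ⟨
    q + (p + 2)     ≤⟨ +-monoʳ-≤ q (subst (_≤ B) (+-comm 2 p) (≤∧≢⇒< p<B 1+p≢B)) ⟩
    q + B           ∎))
    where open ≤-Reasoning
  B≤q : B ≤ q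
  B≤q = +-cancelʳ-≤ N B q (begin
    B + N           ≡⟨ +-comm B N ⟩
    N + B           ≡⟨ p+q+2≡N+B ⟨
    p + q + 2       ≡⟨ identity p q ⟨
    q + (p + 2)     ≤⟨ +-monoʳ-≤ q (subst (_≤ N) (+-comm 2 p) (≤∧≢⇒< p<N 1+p≢N)) ⟩
    q + N           ∎)
    where open ≤-Reasoning

module Letters (α : Irrational) (N : ℕ) .{{_ : NonZero N}} (fl : ℕ → ℤ) (u : ℕ → ℕ) where
  open RealOrder α

  letter : Lin → Letter
  letter x =
    if all (λ i → leB α x (gap α N fl u i)) (upTo N) then a
    else if all (λ i → leB α (gap α N fl u i) x) (upTo N) ∧ hasMiddle α N fl u then c
    else b

  word≡letter : ∀ {j x} → gap α N fl u j ≡ x → word α N fl u j ≡ letter x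
  word≡letter = cong letter

  module TwoLengths (sm lg : Lin) (sm<lg : sm <[ α ] lg)
                    (two-valued : ∀ j → gap α N fl u j ≡ sm ⊎ gap α N fl u j ≡ lg)
                    (i : ℕ) (i<N : i < N) (gap-i≡sm : gap α N fl u i ≡ sm) where

    sm-minimal : all (λ j → leB α sm (gap α N fl u j)) (upTo N) ≡ true
    sm-minimal = all-upTo-true _ N λ {j} _ → ≮⇒leB sm (gap α N fl u j) (sm≤ j)
      where
      sm≤ : ∀ j → ¬ (gap α N fl u j <[ α ] sm)
      sm≤ j with two-valued j
      ... | inj₁ refl = lt-irrefl sm
      ... | inj₂ refl = lt-asym sm lg sm<lg

    lg-maximal : all (λ j → leB α (gap α N fl u j) lg) (upTo N) ≡ true
    lg-maximal = all-upTo-true _ N λ {j} _ → ≮⇒leB (gap α N fl u j) lg (≤lg j)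
      where
      ≤lg : ∀ j → ¬ (lg <[ α ] gap α N fl u j)
      ≤lg j with two-valued j
      ... | inj₁ refl = lt-asym sm lg sm<lg
      ... | inj₂ refl = lt-irrefl lg

    lg-not-minimal : all (λ j → leB α lg (gap α N fl u j)) (upTo N) ≡ false
    lg-not-minimal = ¬-not λ lg-min →
      leB⇒≮ lg (gap α N fl u i) (all-upTo-true⁻ _ N lg-min i<N) (subst (_<[ α ] lg) (sym gap-i≡sm) sm<lg)

    no-middle : hasMiddle α N fl u ≡ false
    no-middle = any-upTo-false _ N λ {j} _ → extreme j
      where
      extreme : ∀ j → not (isMin α N fl u j) ∧ not (isMax α N fl u j) ≡ false
      extreme j with two-valued j
      ... | inj₁ gap≡sm rewrite gap≡sm | sm-minimal = refl
      ... | inj₂ gap≡lg rewrite gap≡lg | lg-maximal = ∧-zeroʳ _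

    letter-sm : letter sm ≡ a
    letter-sm rewrite sm-minimal = refl

    letter-lg : letter lg ≡ b
    letter-lg rewrite lg-not-minimal | lg-maximal | no-middle = refl

module OrderedFractionalParts (α : Irrational) (N : ℕ) .{{_ : NonZero N}} (fl : ℕ → ℤ)
       (isFloor : ∀ m → IsFloor α m (fl m)) (u : ℕ → ℕ) (isOrderPerm : IsOrderPerm α N fl u) where
  open RealOrder α

  X : ℕ → Lin
  X = frac fl

  0ℓ 1ℓ : Lin
  0ℓ = (+ 0 , + 0)
  1ℓ = (+ 1 , + 0)

  u<N : ∀ {j} → j < N → u j < N
  u<N = proj₁ isOrderPerm _

  u-surjective : ∀ {m} → m < N → Σ ℕ λ j → j < N × u j ≡ m
  u-surjective = proj₁ (proj₂ isOrderPerm) _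

  X∘u-step : ∀ {j} → suc j < N → X (u j) <[ α ] X (u (suc j))
  X∘u-step = proj₂ (proj₂ isOrderPerm) _

  X-nonneg : ∀ m → ¬ (X m <[ α ] 0ℓ)
  X-nonneg m X<0 = proj₁ (isFloor m) (subst Pos (cong (_, _) (sym (identity (fl m)))) X<0)
    where
    identity : ∀ f → f ℤ.+ ℤ.- + 0 ≡ + 0 ℤ.+ ℤ.- (ℤ.- f)
    identity = ℤ-Solver.solve-∀

  X<1 : ∀ m → X m <[ α ] 1ℓ
  X<1 m = subst Pos (cong (_, _) (identity (fl m))) (proj₂ (isFloor m))
    where
    identity : ∀ f → f ℤ.+ + 1 ℤ.+ ℤ.- + 0 ≡ + 1 ℤ.+ ℤ.- (ℤ.- f)
    identity = ℤ-Solver.solve-∀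

  X0≡0 : X 0 ≡ 0ℓ
  X0≡0 = cong (λ f → ℤ.- f , + 0) (fl0≡0 (fl 0) (isFloor 0))
    where
    fl0≡0 : ∀ f → IsFloor α 0 f → f ≡ + 0
    fl0≡0 (+ zero)        _       = refl
    fl0≡0 +[1+ n ]        (0≮f , _) = ⊥-elim (0≮f refl)
    fl0≡0 -[1+ zero ]     (_ , ())
    fl0≡0 -[1+ suc n ]    (_ , ())

  X∘u-mono : ∀ {i j} → i < j → j < N → X (u i) <[ α ] X (u j)
  X∘u-mono {i} {suc j} (s≤s i≤j) 1+j<N with m≤n⇒m<n∨m≡n i≤j
  ... | inj₁ i<j  = lt-trans (X (u i)) (X (u j)) (X (u (suc j)))
                      (X∘u-mono i<j (<-trans (n<1+n j) 1+j<N)) (X∘u-step 1+j<N)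
  ... | inj₂ refl = X∘u-step 1+j<N

  u-injective : ∀ {i j} → i < N → j < N → u i ≡ u j → i ≡ j
  u-injective {i} {j} i<N j<N ui≡uj with <-cmp i j
  ... | tri< i<j _ _ = ⊥-elim (lt-irrefl (X (u i))
                         (subst (λ m → X (u i) <[ α ] X m) (sym ui≡uj) (X∘u-mono i<j j<N)))
  ... | tri≈ _ i≡j _ = i≡j
  ... | tri> _ _ j<i = ⊥-elim (lt-irrefl (X (u j))
                         (subst (λ m → X (u j) <[ α ] X m) ui≡uj (X∘u-mono j<i i<N)))

  0<N : 0 < N
  0<N = >-nonZero⁻¹ N

  N-1<N : N ∸ 1 < N
  N-1<N = subst (N ∸ 1 <_) (suc-pred N) (n<1+n (N ∸ 1))

  u0≡0 : u 0 ≡ 0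
  u0≡0 with u-surjective 0<N
  ... | zero  , _ , u0≡0 = u0≡0
  ... | suc j , 1+j<N , u[1+j]≡0 = ⊥-elim (X-nonneg (u 0)
          (subst (X (u 0) <[ α ]_) (trans (cong X u[1+j]≡0) X0≡0) (X∘u-mono z<s 1+j<N)))

  last-index : ∀ {j} → j < N → ¬ (suc j < N) → j ≡ N ∸ 1
  last-index j<N 1+j≮N = ≤-antisym (<⇒≤pred j<N) (pred-mono-≤ (≮⇒≥ 1+j≮N))

  X∘u1-least : ∀ {m} → 1 ≤ m → m < N → ¬ (X m <[ α ] X (u 1))
  X∘u1-least {m} 1≤m m<N Xm<Xu1 with u-surjective m<N
  ... | zero , _ , u0≡m = <⇒≢ 1≤m (trans (sym u0≡0) u0≡m)
  ... | suc zero , _ , u1≡m = lt-irrefl (X m) (subst (λ k → X m <[ α ] X k) u1≡m Xm<Xu1)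
  ... | suc (suc j) , 2+j<N , uj≡m = lt-asym (X (u 1)) (X m)
          (subst (λ k → X (u 1) <[ α ] X k) uj≡m (X∘u-mono (s≤s z<s) 2+j<N)) Xm<Xu1

  X∘u[N-1]-greatest : ∀ {m} → m < N → ¬ (X (u (N ∸ 1)) <[ α ] X m)
  X∘u[N-1]-greatest {m} m<N Xu[N-1]<Xm with u-surjective m<N
  ... | j , j<N , uj≡m with j ≟ N ∸ 1
  ... | yes refl = lt-irrefl (X m) (subst (λ k → X k <[ α ] X m) uj≡m Xu[N-1]<Xm)
  ... | no j≢N-1 = lt-asym (X (u (N ∸ 1))) (X m) Xu[N-1]<Xm
          (subst (λ k → X k <[ α ] X (u (N ∸ 1))) uj≡m (X∘u-mono j<N-1 N-1<N))
    where
    j<N-1 : j < N ∸ 1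
    j<N-1 = ≤∧≢⇒< (≤-pred (subst (suc j ≤_) (sym (suc-pred N)) j<N)) j≢N-1

  carry : ℕ → ℕ → ℤ
  carry m n = fl m ℤ.+ fl n ℤ.- fl (m + n)

  X-+-carry : ∀ m n → X (m + n) ⊝ X n ≡ X m ⊕ (carry m n , + 0)
  X-+-carry m n = cong₂ _,_ (identity (fl m) (fl n) (fl (m + n))) (identity′ (+ m) (+ n))
    where
    identity : ∀ a b c → ℤ.- c ℤ.+ ℤ.- (ℤ.- b) ≡ ℤ.- a ℤ.+ (a ℤ.+ b ℤ.- c)
    identity = ℤ-Solver.solve-∀
    identity′ : ∀ a b → (a ℤ.+ b) ℤ.+ ℤ.- b ≡ a ℤ.+ + 0
    identity′ = ℤ-Solver.solve-∀

  X-+-borrow : ∀ m n → X m ⊝ X (m + n) ≡ (1ℓ ⊝ X n) ⊕ (ℤ.- carry m n ℤ.- + 1 , + 0)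
  X-+-borrow m n = cong₂ _,_ (identity (fl m) (fl n) (fl (m + n))) (identity′ (+ m) (+ n))
    where
    identity : ∀ a b c →
               ℤ.- a ℤ.+ ℤ.- (ℤ.- c) ≡ (+ 1 ℤ.+ ℤ.- (ℤ.- b)) ℤ.+ (ℤ.- (a ℤ.+ b ℤ.- c) ℤ.- + 1)
    identity = ℤ-Solver.solve-∀
    identity′ : ∀ a b → a ℤ.+ ℤ.- (a ℤ.+ b) ≡ (+ 0 ℤ.+ ℤ.- b) ℤ.+ + 0
    identity′ = ℤ-Solver.solve-∀

  δ : ℕ → Lin
  δ = gap α N fl u

  gapAt : ℕ → Lin
  gapAt i = if suc i <ᵇ N then X (u (suc i)) ⊝ X (u i) else 1ℓ ⊝ X (u i)

  δ≡gapAt : ∀ {i} → i < N → δ i ≡ gapAt i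
  δ≡gapAt i<N = cong gapAt (m<n⇒m%n≡m i<N)

  gapAt-inner : ∀ {i} → suc i < N → gapAt i ≡ X (u (suc i)) ⊝ X (u i)
  gapAt-inner 1+i<N rewrite Equivalence.to T-≡ (<⇒<ᵇ 1+i<N) = refl

  α-coefficient : ∀ {i x q} → suc i < N → gapAt i ≡ x → proj₂ x ≡ q → + u (suc i) ℤ.- + u i ≡ q
  α-coefficient 1+i<N refl refl = sym (cong proj₂ (gapAt-inner 1+i<N))

  gapAt-last : ∀ {i} → suc i ≡ N → gapAt i ≡ 1ℓ ⊝ X (u i)
  gapAt-last {i} 1+i≡N with suc i <ᵇ N in 1+i<ᵇN
  ... | true  = ⊥-elim (<-irrefl 1+i≡N (<ᵇ⇒< (suc i) N (subst T (sym 1+i<ᵇN) _)))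
  ... | false = refl

  module AtRelabelingTime (i₀ k₀ : ℕ) (i₀<N : i₀ < N) (k₀<N : k₀ < N)
         (δi₀≉δk₀ : ¬ (δ i₀ ≈[ α ] δ k₀))
         (two-lengths : ∀ j → j < N → δ j ≈[ α ] δ i₀ ⊎ δ j ≈[ α ] δ k₀) where

    1<N : 1 < N
    1<N = ≰⇒> λ N≤1 → δi₀≉δk₀ (≡⇒≈ (cong δ (trans (n<1⇒n≡0 (<-≤-trans i₀<N N≤1))
                                                   (sym (n<1⇒n≡0 (<-≤-trans k₀<N N≤1))))))

    A B : ℕ
    A = u 1
    B = u (N ∸ 1)

    g h : Lin
    g = gapAt 0
    h = gapAt (N ∸ 1)

    g≡ : g ≡ X A ⊝ X (u 0)
    g≡ = gapAt-inner 1<N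

    h≡ : h ≡ 1ℓ ⊝ X B
    h≡ = gapAt-last (suc-pred N)

    α-coefficient-g : proj₂ g ≡ + A
    α-coefficient-g = trans (cong proj₂ g≡) (trans (cong (λ m → + A ℤ.- + m) u0≡0) (ℤ.+-identityʳ (+ A)))

    α-coefficient-h : proj₂ h ≡ ℤ.- + B
    α-coefficient-h = trans (cong proj₂ h≡) (ℤ.+-identityˡ (ℤ.- + B))

    A≢0 : A ≢ 0
    A≢0 A≡0 with () ← u-injective 1<N 0<N (trans A≡0 (sym u0≡0))

    B≢0 : B ≢ 0
    B≢0 B≡0 = <⇒≢ (<⇒≤pred 1<N) (sym (u-injective N-1<N 0<N (trans B≡0 (sym u0≡0))))

    g≢h : g ≢ h
    g≢h g≡h = +A≢-+B (trans (sym α-coefficient-g) (trans (cong proj₂ g≡h) α-coefficient-h))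
      where
      +A≢-+B : + A ≢ ℤ.- + B
      +A≢-+B with A | A≢0 | B
      ... | zero  | A≢0 | _     = λ _ → A≢0 refl
      ... | suc _ | _   | zero  = λ ()
      ... | suc _ | _   | suc _ = λ ()

    δ-two-valued : ∀ j → δ j ≡ g ⊎ δ j ≡ h
    δ-two-valued j = one-of-two g≢h (among 0<N) (among N-1<N) (among (m%n<n j N))
      where
      among : ∀ {i} → i < N → gapAt i ≡ δ i₀ ⊎ gapAt i ≡ δ k₀
      among i<N = Data.Sum.map (trans (sym (δ≡gapAt i<N)) ∘ ≈⇒≡) (trans (sym (δ≡gapAt i<N)) ∘ ≈⇒≡)
                               (two-lengths _ i<N)

    gapAt-two-valued : ∀ {i} → i < N → gapAt i ≡ g ⊎ gapAt i ≡ h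
    gapAt-two-valued {i} i<N = subst (λ x → x ≡ g ⊎ x ≡ h) (δ≡gapAt i<N) (δ-two-valued i)

    u-step : ∀ {i} → suc i < N →
             (u (suc i) ≡ u i + A × gapAt i ≡ g) ⊎ (u (suc i) + B ≡ u i × gapAt i ≡ h)
    u-step {i} 1+i<N with gapAt-two-valued (<-trans (n<1+n i) 1+i<N)
    ... | inj₁ gap≡g = inj₁ (ℤ-difference⁺ _ _ _ (α-coefficient 1+i<N gap≡g α-coefficient-g) , gap≡g)
    ... | inj₂ gap≡h = inj₂ (ℤ-difference⁻ _ _ _ (α-coefficient 1+i<N gap≡h α-coefficient-h) , gap≡h)

    Pos-XA : Pos (X A)
    Pos-XA = 0<⇒Pos (X A) (subst (_<[ α ] X A) (trans (cong X u0≡0) X0≡0) (X∘u-mono z<s 1<N))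

    -- If A + B < N, {(A+B)α} = {Aα} + {Bα} − carry would lie above {Bα} (carry ≥ 0)
    -- or below {Aα} (carry < 0).
    N≤A+B : N ≤ A + B
    N≤A+B = ≮⇒≥ λ A+B<N → contradiction A+B<N (carry A B) (X-+-carry A B) (X-+-borrow A B)
      where
      contradiction : A + B < N → ∀ K → X (A + B) ⊝ X B ≡ X A ⊕ (K , + 0) →
                      X A ⊝ X (A + B) ≡ (1ℓ ⊝ X B) ⊕ (ℤ.- K ℤ.- + 1 , + 0) → ⊥
      contradiction A+B<N (+ n) above _ =
        X∘u[N-1]-greatest A+B<N (subst Pos (sym above) (Pos-⊕-ℕ (X A) n Pos-XA))
      contradiction A+B<N -[1+ n ] _ below =
        X∘u1-least (≤-trans (n≢0⇒n>0 A≢0) (m≤m+n A B)) A+B<N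
          (subst Pos (sym below) (Pos-⊕-ℕ (1ℓ ⊝ X B) n (X<1 B)))

    -- If A + B > N, the successor of B − 1 in the order u would be B − 1 + A ≥ N or −1.
    A+B≤N : A + B ≤ N
    A+B≤N = ≮⇒≥ λ N<A+B → no-successor N<A+B (u-surjective (<-trans B-1<B (u<N N-1<N)))
      where
      1+[B-1]≡B : suc (B ∸ 1) ≡ B
      1+[B-1]≡B = suc-pred B {{≢-nonZero B≢0}}
      B-1<B : B ∸ 1 < B
      B-1<B = subst (B ∸ 1 <_) 1+[B-1]≡B (n<1+n (B ∸ 1))
      A+B≡1+[B-1+A] : A + B ≡ suc (B ∸ 1 + A)
      A+B≡1+[B-1+A] = trans (cong (λ k → A + k) (sym 1+[B-1]≡B))
                            (trans (+-suc A (B ∸ 1)) (cong suc (+-comm A (B ∸ 1))))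
      no-successor : N < A + B → Σ ℕ (λ j → j < N × u j ≡ B ∸ 1) → ⊥
      no-successor N<A+B (j , j<N , uj≡B-1) with suc j <? N
      ... | no 1+j≮N = <⇒≢ B-1<B (trans (sym uj≡B-1) (cong u (last-index j<N 1+j≮N)))
      ... | yes 1+j<N with u-step 1+j<N
      ...   | inj₁ (u[1+j]≡uj+A , _) = <⇒≱ (u<N 1+j<N) (begin
                N             ≤⟨ ≤-pred (subst (N <_) A+B≡1+[B-1+A] N<A+B) ⟩
                B ∸ 1 + A     ≡⟨ cong (_+ A) uj≡B-1 ⟨
                u j + A       ≡⟨ u[1+j]≡uj+A ⟨
                u (suc j)     ∎)
        where open ≤-Reasoning
      ...   | inj₂ (u[1+j]+B≡uj , _) = <⇒≱ B-1<B (begin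
                B             ≤⟨ m≤n+m B (u (suc j)) ⟩
                u (suc j) + B ≡⟨ u[1+j]+B≡uj ⟩
                u j           ≡⟨ uj≡B-1 ⟩
                B ∸ 1         ∎)
        where open ≤-Reasoning

    A+B≡N : A + B ≡ N
    A+B≡N = ≤-antisym A+B≤N N≤A+B

    0<B : 0 < B
    0<B = n≢0⇒n>0 B≢0

    B<N : B < N
    B<N = u<N N-1<N

    u-step-cyclic : ∀ {i} → i < N →
                    (u i < B × gapAt i ≡ g × u (suc i % N) ≡ u i + A)
                  ⊎ (B ≤ u i × gapAt i ≡ h × u (suc i % N) + B ≡ u i)
    u-step-cyclic {i} i<N with suc i <? N
    ... | yes 1+i<N rewrite m<n⇒m%n≡m 1+i<N with u-step 1+i<N
    ...   | inj₁ (u[1+i]≡ui+A , gap≡g) = inj₁ (ui<B , gap≡g , u[1+i]≡ui+A)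
      where
      ui<B : u i < B
      ui<B = +-cancelʳ-< A (u i) B (subst₂ _<_ u[1+i]≡ui+A (trans (sym A+B≡N) (+-comm A B)) (u<N 1+i<N))
    ...   | inj₂ (u[1+i]+B≡ui , gap≡h) = inj₂ (subst (B ≤_) u[1+i]+B≡ui (m≤n+m B _) , gap≡h , u[1+i]+B≡ui)
    u-step-cyclic {i} i<N | no 1+i≮N with refl ← last-index i<N 1+i≮N =
      inj₂ (≤-refl , refl , cong (_+ B) (trans (cong u 1+[N-1]%N≡0) u0≡0))
      where
      1+[N-1]%N≡0 : suc (N ∸ 1) % N ≡ 0
      1+[N-1]%N≡0 = trans (cong (_% N) (suc-pred N)) (n%n≡0 N)

    u-step-mod : ∀ i → u (suc i % N) ≡ u (i % N) + A ⊎ u (suc i % N) + B ≡ u (i % N)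
    u-step-mod i with u-step-cyclic (m%n<n i N)
    ... | inj₁ (_ , _ , step) = inj₁ (trans (cong u (sym (suc[m%n]%n≡suc[m]%n i N))) step)
    ... | inj₂ (_ , _ , step) = inj₂ (trans (cong (λ j → u j + B) (sym (suc[m%n]%n≡suc[m]%n i N))) step)

    gapAt-small : ∀ {i} → i < N → u i < B → gapAt i ≡ g
    gapAt-small i<N ui<B with u-step-cyclic i<N
    ... | inj₁ (_ , gap≡g , _) = gap≡g
    ... | inj₂ (B≤ui , _ , _)  = ⊥-elim (<⇒≱ ui<B B≤ui)

    gapAt-large : ∀ {i} → i < N → B ≤ u i → gapAt i ≡ h
    gapAt-large i<N B≤ui with u-step-cyclic i<N
    ... | inj₁ (ui<B , _ , _) = ⊥-elim (<⇒≱ ui<B B≤ui)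
    ... | inj₂ (_ , gap≡h , _) = gap≡h

    module AtLargest (J : ℕ) (J<N : J < N) (uJ≡N-1 : u J ≡ N ∸ 1) where

      J≢0 : J ≢ 0
      J≢0 J≡0 = <⇒≢ (<⇒≤pred 1<N) (trans (sym u0≡0) (trans (cong u (sym J≡0)) uJ≡N-1))

      1+[J-1]≡J : suc (J ∸ 1) ≡ J
      1+[J-1]≡J = suc-pred J {{≢-nonZero J≢0}}

      J-1<N : J ∸ 1 < N
      J-1<N = <-trans (subst (J ∸ 1 <_) 1+[J-1]≡J (n<1+n (J ∸ 1))) J<N

      1+[J-1]%N≡J : suc (J ∸ 1) % N ≡ J
      1+[J-1]%N≡J = trans (cong (_% N) 1+[J-1]≡J) (m<n⇒m%n≡m J<N)

      step-into-J : u (J ∸ 1) + A ≡ N ∸ 1 × gapAt (J ∸ 1) ≡ g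
      step-into-J with u-step-cyclic J-1<N
      ... | inj₁ (_ , gap≡g , u[J]≡u[J-1]+A) =
              trans (sym u[J]≡u[J-1]+A) (trans (cong u 1+[J-1]%N≡J) uJ≡N-1) , gap≡g
      ... | inj₂ (_ , _ , u[J]+B≡u[J-1]) = ⊥-elim (<⇒≱ (u<N J-1<N) (begin
              N                        ≡⟨ suc-pred N ⟨
              suc (N ∸ 1)              ≡⟨ +-comm 1 (N ∸ 1) ⟩
              N ∸ 1 + 1                ≤⟨ +-monoʳ-≤ (N ∸ 1) 0<B ⟩
              N ∸ 1 + B                ≡⟨ cong (_+ B) uJ≡N-1 ⟨
              u J + B                  ≡⟨ cong (λ j → u j + B) 1+[J-1]%N≡J ⟨
              u (suc (J ∸ 1) % N) + B  ≡⟨ u[J]+B≡u[J-1] ⟩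
              u (J ∸ 1)                ∎))
        where open ≤-Reasoning

      δ[J-1]≡g : δ (J + N ∸ 1) ≡ g
      δ[J-1]≡g = trans (cong gapAt [J+N-1]%N≡J-1) (proj₂ step-into-J)
        where
        [J+N-1]%N≡J-1 : (J + N ∸ 1) % N ≡ J ∸ 1
        [J+N-1]%N≡J-1 = begin
          (J + N ∸ 1) % N          ≡⟨ cong (λ j → (j + N ∸ 1) % N) 1+[J-1]≡J ⟨
          (J ∸ 1 + N) % N          ≡⟨ [m+n]%n≡m%n (J ∸ 1) N ⟩
          (J ∸ 1) % N              ≡⟨ m<n⇒m%n≡m J-1<N ⟩
          J ∸ 1                    ∎
          where open ≡-Reasoning

      δJ≡h : δ J ≡ h
      δJ≡h = trans (δ≡gapAt J<N) (gapAt-large J<N (subst (B ≤_) (sym uJ≡N-1) (<⇒≤pred B<N)))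

      open Letters α N fl u

      letters-at-J : ((word α N fl u (J + N ∸ 1) ≡ a) × (word α N fl u J ≡ b))
                   ⊎ ((word α N fl u (J + N ∸ 1) ≡ b) × (word α N fl u J ≡ a))
      letters-at-J with lt-cmp g h
      ... | inj₁ g<h =
              inj₁ (trans (word≡letter δ[J-1]≡g) letter-sm , trans (word≡letter δJ≡h) letter-lg)
        where open TwoLengths g h g<h δ-two-valued 0 0<N (δ≡gapAt 0<N)
      ... | inj₂ (inj₁ h≡g) = ⊥-elim (g≢h (sym h≡g))
      ... | inj₂ (inj₂ h<g) =
              inj₂ (trans (word≡letter δ[J-1]≡g) letter-lg , trans (word≡letter δJ≡h) letter-sm)
        where open TwoLengths h g h<g (Data.Sum.swap ∘ δ-two-valued) (N ∸ 1) N-1<N (δ≡gapAt N-1<N)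

      -- M ∸ k ≡ J − 1 − k (mod N); the 2N keeps ∸ from truncating.
      M : ℕ
      M = J + 2 * N ∸ 1

      right left : ℕ → ℕ
      right k = u ((J + k) % N)
      left  k = u ((M ∸ k) % N)

      right-step : ∀ k → right (suc k) ≡ right k + A ⊎ right (suc k) + B ≡ right k
      right-step k = subst (λ i → u (i % N) ≡ right k + A ⊎ u (i % N) + B ≡ right k)
                           (sym (+-suc J k)) (u-step-mod (J + k))

      left-step : ∀ k → suc k ≤ M → left k ≡ left (suc k) + A ⊎ left k + B ≡ left (suc k)
      left-step k 1+k≤M = subst (λ i → u (i % N) ≡ left (suc k) + A ⊎ u (i % N) + B ≡ left (suc k))
                                (sym (+-∸-assoc 1 1+k≤M)) (u-step-mod (M ∸ suc k))

      M≡J-1+2N : M ≡ J ∸ 1 + 2 * N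
      M≡J-1+2N = cong (λ j → j + 2 * N ∸ 1) (sym 1+[J-1]≡J)

      N≤M : N ≤ M
      N≤M = subst (N ≤_) (sym M≡J-1+2N) (≤-trans (m≤m+n N (N + 0)) (m≤n+m (2 * N) (J ∸ 1)))

      right0≡N-1 : right 0 ≡ N ∸ 1
      right0≡N-1 = trans (cong (λ j → u (j % N)) (+-identityʳ J)) (trans (cong u (m<n⇒m%n≡m J<N)) uJ≡N-1)

      left0≡u[J-1] : left 0 ≡ u (J ∸ 1)
      left0≡u[J-1] = cong u (begin
        M % N                  ≡⟨ cong (_% N) M≡J-1+2N ⟩
        (J ∸ 1 + 2 * N) % N    ≡⟨ [m+kn]%n≡m%n (J ∸ 1) 2 N ⟩
        (J ∸ 1) % N            ≡⟨ m<n⇒m%n≡m J-1<N ⟩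
        J ∸ 1                  ∎)
        where open ≡-Reasoning

      sum-invariant : ∀ k → k < N → SumInvariant N B (right k + left k)
      sum-invariant zero _ = inj₂ (begin
        right 0 + left 0 + 2         ≡⟨ cong₂ (λ p q → p + q + 2) right0≡N-1 left0≡u[J-1] ⟩
        N ∸ 1 + u (J ∸ 1) + 2        ≡⟨ identity (N ∸ 1) (u (J ∸ 1)) ⟩
        suc (N ∸ 1) + suc (u (J ∸ 1)) ≡⟨ cong₂ _+_ (suc-pred N) 1+u[J-1]≡B ⟩
        N + B                        ∎)
        where
        open ≡-Reasoning
        identity : ∀ n v → n + v + 2 ≡ suc n + suc v
        identity = solve-∀
        1+u[J-1]≡B : suc (u (J ∸ 1)) ≡ B
        1+u[J-1]≡B = +-cancelˡ-≡ A _ _ (begin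
          A + suc (u (J ∸ 1))   ≡⟨ +-suc A _ ⟩
          suc (A + u (J ∸ 1))   ≡⟨ cong suc (+-comm A _) ⟩
          suc (u (J ∸ 1) + A)   ≡⟨ cong suc (proj₁ step-into-J) ⟩
          suc (N ∸ 1)           ≡⟨ suc-pred N ⟩
          N                     ≡⟨ A+B≡N ⟨
          A + B                 ∎)
      sum-invariant (suc k) 1+k<N =
        SumInvariant-step 0<B B<N (sum+2≤N+N (u<N (m%n<n _ N)) (u<N (m%n<n _ N)))
          (opposite-steps A+B≡N (right-step k) (left-step k (≤-trans (<⇒≤ 1+k<N) N≤M)))
          (sum-invariant k (<-trans (n<1+n k) 1+k<N))

      right-avoids-top : ∀ {k} → 0 < k → k < N → suc (right k) ≢ N
      right-avoids-top {k} 0<k k<N 1+right≡N = [m+k]%n≢m J<N 0<k k<N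
        (u-injective (m%n<n (J + k) N) J<N
          (trans (suc-injective (trans 1+right≡N (sym (suc-pred N)))) (sym uJ≡N-1)))

      right-avoids-B-1 : ∀ {k} → suc k < N → suc (right k) ≢ B
      right-avoids-B-1 {k} 1+k<N 1+right≡B with right-step k
      ... | inj₁ right[1+k]≡right+A = right-avoids-top z<s 1+k<N (begin
            suc (right (suc k))    ≡⟨ cong suc right[1+k]≡right+A ⟩
            suc (right k + A)      ≡⟨ +-comm A (suc (right k)) ⟨
            A + suc (right k)      ≡⟨ cong (λ b → A + b) 1+right≡B ⟩
            A + B                  ≡⟨ A+B≡N ⟩
            N                      ∎)
        where open ≡-Reasoning
      ... | inj₂ right[1+k]+B≡right = <⇒≱ (n<1+n (right k)) (begin
            suc (right k)          ≡⟨ 1+right≡B ⟩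
            B                      ≤⟨ m≤n+m B (right (suc k)) ⟩
            right (suc k) + B      ≡⟨ right[1+k]+B≡right ⟩
            right k                ∎)
        where open ≤-Reasoning

      mirror : ∀ k → 1 ≤ k → k ≤ N ∸ 2 → word α N fl u (M ∸ k) ≡ word α N fl u (J + k)
      mirror k 1≤k k≤N-2
        with SumInvariant-sides (u<N (m%n<n _ N)) (u<N (m%n<n _ N))
               (right-avoids-top 1≤k k<N) (right-avoids-B-1 1+k<N) (sum-invariant k k<N)
        where
        1+k<N : suc k < N
        1+k<N = begin
          2 + k         ≡⟨ +-comm 2 k ⟩
          k + 2         ≤⟨ +-monoˡ-≤ 2 k≤N-2 ⟩
          N ∸ 2 + 2     ≡⟨ m∸n+n≡m 1<N ⟩
          N             ∎
          where open ≤-Reasoning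
        k<N : k < N
        k<N = <-trans (n<1+n k) 1+k<N
      ... | inj₁ (right<B , left<B) =
              cong letter (trans (gapAt-small (m%n<n _ N) left<B) (sym (gapAt-small (m%n<n _ N) right<B)))
      ... | inj₂ (B≤right , B≤left) =
              cong letter (trans (gapAt-large (m%n<n _ N) B≤left) (sym (gapAt-large (m%n<n _ N) B≤right)))

proposition1 : (α : Irrational) (N : ℕ) .{{_ : NonZero N}}
    (fl : ℕ → ℤ) → (∀ m → IsFloor α m (fl m))
    → (u : ℕ → ℕ) → IsOrderPerm α N fl u
    → RelabelingTime α N fl u
    → (J : ℕ) → J < N → u J ≡ N ∸ 1
    → (((word α N fl u (J + N ∸ 1) ≡ a) × (word α N fl u J ≡ b))
        ⊎ ((word α N fl u (J + N ∸ 1) ≡ b) × (word α N fl u J ≡ a)))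
      × (∀ k → 1 ≤ k → k ≤ N ∸ 2
          → word α N fl u (J + 2 * N ∸ 1 ∸ k) ≡ word α N fl u (J + k))
proposition1 α N fl isFloor u isOrderPerm (i₀ , k₀ , i₀<N , k₀<N , δi₀≉δk₀ , two-lengths)
             J J<N uJ≡N-1 =
  letters-at-J , mirror
  where
  open OrderedFractionalParts α N fl isFloor u isOrderPerm
  open AtRelabelingTime i₀ k₀ i₀<N k₀<N δi₀≉δk₀ two-lengths
  open AtLargest J J<N uJ≡N-1
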